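{- Let $w_{\min},w_{\max}$ be reals, $S=((a_1,w_1),\ldots,(a_n,w_n))$ a sequence of pairs of reals with $w_i>0$, and let $r\le y_0$ be indices with $w(r,y_0)\ge w_{\min}$. Let $\ell=\ell_{y_0}$ and let $y_1$ be the largest index with $w(r,y_1)\le w_{\max}$; put $X=[\ell,r]$, $Y=[y_0,y_1]$. Then algorithm VMAIN$(r,y_0)$ (described in the context) correctly solves the variant problem: among its output pairs $(x_y,y)$, $y\in Y$, there is one such that $w_{\min}\le w(x_y,y)\le w_{\max}$ and $d(x_y,y)=\max\{d(x,y): x\in X,\ y\in Y,\ w_{\min}\le w(x,y)\le w_{\max}\}$.
   Context: For $1\le i\le j\le n$, $w(i,j)=w_i+\cdots+w_j$ and $d(i,j)=(a_i+\cdots+a_j)/w(i,j)$. For integers $x\le y$, $[x,y]=\{x,\ldots,y\}$, and $\phi(x,y)$ is the largest $z\in[x,y]$ minimizing $d(x,z)$. For an index $y$, $\ell_y$ is the smallest index $i$ with $w_{\min}\le w(i,y)\le w_{\max}$ (presupposed to exist). BEST$(\ell,r,j)$: $i:=\ell$; while $i<r$ and $d(i,\phi(i,r-1))\le d(i,j)$: $i:=\phi(i,r-1)+1$; return $i$. VMAIN$(r,y_0)$: let $\ell$ be the smallest index in $[1,n]$ with $w(\ell,y_0)\le w_{\max}$; let $y_1$ be the largest index in $[1,n]$ with $w(r,y_1)\le w_{\max}$; $x_{y_0-1}:=\ell$; for $y=y_0$ to $y_1$: { $x_y:=$ BEST$(\max(x_{y-1},\ell_y),r,y)$; output $(x_y,y)$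 }.
   Formalization: The numbers $a_i$, $w_i$, $w_{\min}$ and $w_{\max}$ are rational rather than real. -}

module Defs where

open import Data.Nat as ℕ using (ℕ; zero; suc; _∸_; _⊔_)
open import Data.Bool using (Bool; true; false; if_then_else_; _∧_)
open import Data.List using (List; []; _∷_; foldl)
open import Data.Product using (_×_; _,_)
open import Relation.Nullary using (yes; no; does)
open import Data.Rational as ℚ using (ℚ; 0ℚ; _+_; _÷_; ≢-nonZero)
open import Data.Rational.Properties using (_≟_)

-- Indices are natural numbers; only indices in [1,n] are meaningful.
-- Sum f(i) + f(i+1) + ... (len terms)
sumFrom : (ℕ → ℚ) → ℕ → ℕ → ℚ
sumFrom f i zero    = 0ℚ
sumFrom f i (suc k) = f i + sumFrom f (suc i) k

rangeSum : (ℕ → ℚ) → ℕ → ℕ → ℚ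
rangeSum f i j = sumFrom f i (suc j ∸ i)

W : (ℕ → ℚ) → ℕ → ℕ → ℚ
W w i j = rangeSum w i j

-- total division: q / p (value 0 when p = 0; never used then, since w(i,j) > 0)
div : ℚ → ℚ → ℚ
div q p with p ≟ 0ℚ
... | yes _  = 0ℚ
... | no p≢0 = _÷_ q p {{≢-nonZero p≢0}}

D : (ℕ → ℚ) → (ℕ → ℚ) → ℕ → ℕ → ℚ
D a w i j = div (rangeSum a i j) (W w i j)

range : ℕ → ℕ → List ℕ
range x y = go x (suc y ∸ x)
  where
  go : ℕ → ℕ → List ℕ
  go i zero    = []
  go i (suc k) = i ∷ go (suc i) k

-- φ(x,y): largest z ∈ [x,y] minimising d(x,z)
-- (scan z = x..y, replacing the current best whenever d(x,z) ≤ d(x,best))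
phi : (ℕ → ℚ) → (ℕ → ℚ) → ℕ → ℕ → ℕ
phi a w x y = foldl step x (range x y)
  where
  step : ℕ → ℕ → ℕ
  step b z = if does (D a w x z ℚ.≤? D a w x b) then z else b

firstSat : (ℕ → Bool) → ℕ → List ℕ → ℕ
firstSat p dflt []       = dflt
firstSat p dflt (i ∷ is) = if p i then i else firstSat p dflt is

lastSat : (ℕ → Bool) → ℕ → List ℕ → ℕ
lastSat p dflt is = foldl (λ b i → if p i then i else b) dflt is

inBounds : ℚ → ℚ → ℚ → Bool
inBounds wmin wmax v = does (wmin ℚ.≤? v) ∧ does (v ℚ.≤? wmax)

ellOf : (ℕ → ℚ) → ℚ → ℚ → ℕ → ℕ
ellOf w wmin wmax y = firstSat (λ i → inBounds wmin wmax (W w i y)) y (range 1 y)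

-- BEST(ℓ, r, j). The while loop is run with fuel; each iteration strictly
-- increases i and stops once i ≥ r, so fuel r+1 never runs out when ℓ ≥ 1.
bestFuel : (ℕ → ℚ) → (ℕ → ℚ) → ℕ → ℕ → ℕ → ℕ → ℕ
bestFuel a w r j zero      i = i
bestFuel a w r j (suc fuel) i with does (i ℕ.<? r)
... | false = i
... | true  with does (D a w i (phi a w i (r ∸ 1)) ℚ.≤? D a w i j)
...   | false = i
...   | true  = bestFuel a w r j fuel (suc (phi a w i (r ∸ 1)))

best : (ℕ → ℚ) → (ℕ → ℚ) → ℕ → ℕ → ℕ → ℕ
best a w ℓ r j = bestFuel a w r j (suc r) ℓ

vmainEll : ℕ → (ℕ → ℚ) → ℚ → ℕ → ℕ
vmainEll n w wmax y0 = firstSat (λ i → does (W w i y0 ℚ.≤? wmax)) 1 (range 1 n)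

-- y1: largest index in [1,n] with w(r,y1) ≤ wmax
-- (searched among y ∈ [r,n], since w(r,y) is only defined for y ≥ r)
yOne : ℕ → (ℕ → ℚ) → ℚ → ℕ → ℕ
yOne n w wmax r = lastSat (λ y → does (W w r y ℚ.≤? wmax)) r (range r n)

vmain : ℕ → (ℕ → ℚ) → (ℕ → ℚ) → ℚ → ℚ → ℕ → ℕ → List (ℕ × ℕ)
vmain n a w wmin wmax r y0 =
  loop (suc (yOne n w wmax r) ∸ y0) y0 (vmainEll n w wmax y0)
  where
  loop : ℕ → ℕ → ℕ → List (ℕ × ℕ)
  loop zero    y xprev = []
  loop (suc k) y xprev =
    let xy = best a w (xprev ⊔ ellOf w wmin wmax y) r y
    in (xy , y) ∷ loop k (suc y) xy

{-# OPTIONS --safe #-}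
module Submission where

-- The density of a concatenation is a mediant: d(i,j) = (A + A′)/(W + W′) for the parts [i,m]
-- and [m+1,j], so with positive weights it lies between d(i,m) and d(m+1,j), strictly unless
-- they coincide.  Hence BEST(ℓ,r,j) returns a start maximising d(·,j) on [ℓ,r]: if the least
-- dense prefix [i,p], p = φ(i,r−1), is no denser than [i,j], every start in [i,p] loses to p+1;
-- otherwise every prefix [i,m] with m < r is denser than [i,j], and no later start beats i.
--
-- For VMAIN, the lower bound wmin holds automatically for x ≤ r ≤ y0 ≤ y, and the upper bound
-- only tightens as y grows.  Fix an optimal feasible pair (x⋆,y⋆).  While x_{y−1} ≤ x⋆ we also
-- have ℓ_y ≤ x⋆, so x⋆ is one of BEST's candidates and d(x⋆,y) ≤ d(x_y,y); at y = y⋆ this is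
-- the claim.  If x_y overtakes x⋆ earlier, splitting both [x⋆,y] and [x⋆,y⋆] at x_y − 1 turns
-- d(x⋆,y) ≤ d(x_y,y) and the optimality d(x_y,y⋆) ≤ d(x⋆,y⋆) into d(x⋆,y⋆) ≤ d(x_y,y).

open import Defs
open import Data.Bool using (true; false; if_then_else_)
open import Data.List using (List; []; _∷_; foldl; filter; cartesianProduct)
open import Data.List.Membership.Propositional using (_∈_; find)
open import Data.List.Membership.Propositional.Properties using (∈-filter⁺; ∈-cartesianProduct⁺)
open import Data.List.Relation.Unary.All using (lookup)
open import Data.List.Relation.Unary.All.Properties using (all-filter)
open import Data.List.Relation.Unary.Any using (Any; here; there)
open import Data.Nat as ℕ using (ℕ; zero; suc; _∸_; _⊔_; _≤_; z≤n; s≤s; _≤‴_; ≤‴-refl; ≤‴-step)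
open import Data.Nat.Properties as ℕ using ()
open import Data.Product using (Σ; _×_; _,_; proj₁; proj₂; map₁)
open import Data.Rational as ℚ using (ℚ; 0ℚ; _<_; _+_; _*_; 1/_; ≢-nonZero; positive) renaming (_≤_ to _≤ℚ_)
open import Data.Rational.Properties as ℚ using (_≟_)
open import Data.Sum as Sum using (_⊎_; inj₁; inj₂)
open import Function using (_∘_; _⇔_; mk⇔; Equivalence)
open import Relation.Binary.Bundles using (DecTotalOrder)
open import Relation.Binary.PropositionalEquality
open import Relation.Nullary using (¬_; yes; no; does; proof; ofʸ; ofⁿ; contradiction)
open import Relation.Nullary.Decidable using (_×-dec_)
open import Relation.Unary using (Decidable)

open import Data.List.Extrema (DecTotalOrder.totalOrder ℚ.≤-decTotalOrder) using (argmax; argmax-all; f[xs]≤f[argmax])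
open Equivalence using (to; from)

-- Mediants

<⇒≱ : ∀ {p q} → p < q → ¬ (q ≤ℚ p)
<⇒≱ p<q q≤p = ℚ.<-irrefl refl (ℚ.<-≤-trans p<q q≤p)

private
  variable
    c s t u v : ℚ

div-*-cancel : 0ℚ < v → div s v * v ≡ s
div-*-cancel {v} {s} 0<v with v ≟ 0ℚ
... | yes v≡0 = contradiction v≡0 (ℚ.<⇒≢ 0<v ∘ sym)
... | no v≢0 = begin
    s * 1/ v * v     ≡⟨ ℚ.*-assoc s (1/ v) v ⟩
    s * (1/ v * v)   ≡⟨ cong (s *_) (ℚ.*-inverseˡ v) ⟩
    s * ℚ.1ℚ         ≡⟨ ℚ.*-identityʳ s ⟩
    s                ∎
  where
  open ≡-Reasoning
  instance _ = ≢-nonZero v≢0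

div-≤⇔ : 0ℚ < v → div s v ≤ℚ c ⇔ s ≤ℚ c * v
div-≤⇔ {v} {s} {c} 0<v = mk⇔
  (λ d≤c → subst (_≤ℚ c * v) (div-*-cancel 0<v) (ℚ.*-monoʳ-≤-nonNeg v d≤c))
  (λ s≤cv → ℚ.*-cancelʳ-≤-pos v (subst (_≤ℚ c * v) (sym (div-*-cancel 0<v)) s≤cv))
  where
  instance
    _ = positive 0<v
    _ = ℚ.pos⇒nonNeg v

≤-div⇔ : 0ℚ < v → c ≤ℚ div s v ⇔ c * v ≤ℚ s
≤-div⇔ {v} {c} {s} 0<v = mk⇔
  (λ c≤d → subst (c * v ≤ℚ_) (div-*-cancel 0<v) (ℚ.*-monoʳ-≤-nonNeg v c≤d))
  (λ cv≤s → ℚ.*-cancelʳ-≤-pos v (subst (c * v ≤ℚ_) (sym (div-*-cancel 0<v)) cv≤s))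
  where
  instance
    _ = positive 0<v
    _ = ℚ.pos⇒nonNeg v

div-<⇔ : 0ℚ < v → div s v < c ⇔ s < c * v
div-<⇔ 0<v = mk⇔
  (λ d<c → ℚ.≰⇒> (<⇒≱ d<c ∘ from (≤-div⇔ 0<v)))
  (λ s<cv → ℚ.≰⇒> (<⇒≱ s<cv ∘ to (≤-div⇔ 0<v)))

<-div⇔ : 0ℚ < v → c < div s v ⇔ c * v < s
<-div⇔ 0<v = mk⇔
  (λ c<d → ℚ.≰⇒> (<⇒≱ c<d ∘ from (div-≤⇔ 0<v)))
  (λ cv<s → ℚ.≰⇒> (<⇒≱ cv<s ∘ to (div-≤⇔ 0<v)))

module _ (0<v : 0ℚ < v) (0<u : 0ℚ < u) where

  private
    0<v+u : 0ℚ < v + u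
    0<v+u = ℚ.+-mono-< 0<v 0<u

    *-distrib : ∀ c → c * v + c * u ≡ c * (v + u)
    *-distrib c = sym (ℚ.*-distribˡ-+ c v u)

  mediant-≤ : div s v ≤ℚ c → div t u ≤ℚ c → div (s + t) (v + u) ≤ℚ c
  mediant-≤ {c = c} p≤c q≤c = from (div-≤⇔ 0<v+u)
    (subst (_ ≤ℚ_) (*-distrib c) (ℚ.+-mono-≤ (to (div-≤⇔ 0<v) p≤c) (to (div-≤⇔ 0<u) q≤c)))

  mediant-< : div s v ≤ℚ c → div t u < c → div (s + t) (v + u) < c
  mediant-< {c = c} p≤c q<c = from (div-<⇔ 0<v+u)
    (subst (_ <_) (*-distrib c) (ℚ.+-mono-≤-< (to (div-≤⇔ 0<v) p≤c) (to (div-<⇔ 0<u) q<c)))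

  ≤-mediant : c ≤ℚ div s v → c ≤ℚ div t u → c ≤ℚ div (s + t) (v + u)
  ≤-mediant {c = c} c≤p c≤q = from (≤-div⇔ 0<v+u)
    (subst (_≤ℚ _) (*-distrib c) (ℚ.+-mono-≤ (to (≤-div⇔ 0<v) c≤p) (to (≤-div⇔ 0<u) c≤q)))

  <-mediant : c < div s v → c ≤ℚ div t u → c < div (s + t) (v + u)
  <-mediant {c = c} c<p c≤q = from (<-div⇔ 0<v+u)
    (subst (_< _) (*-distrib c) (ℚ.+-mono-<-≤ (to (<-div⇔ 0<v) c<p) (to (≤-div⇔ 0<u) c≤q)))

  ≤⇔≤-mediant : div s v ≤ℚ div t u ⇔ div s v ≤ℚ div (s + t) (v + u)
  ≤⇔≤-mediant = mk⇔
    (≤-mediant ℚ.≤-refl)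
    (λ p≤m → ℚ.≮⇒≥ (λ q<p → <⇒≱ (mediant-< ℚ.≤-refl q<p) p≤m))

  ≤⇔mediant-≤ : div s v ≤ℚ div t u ⇔ div (s + t) (v + u) ≤ℚ div t u
  ≤⇔mediant-≤ = mk⇔
    (λ p≤q → mediant-≤ p≤q ℚ.≤-refl)
    (λ m≤q → ℚ.≮⇒≥ (λ q<p → <⇒≱ (<-mediant q<p ℚ.≤-refl) m≤q))

mediant-comm : ∀ s v t u → div (s + t) (v + u) ≡ div (t + s) (u + v)
mediant-comm s v t u = cong₂ div (ℚ.+-comm s t) (ℚ.+-comm v u)

range-cons : ∀ {i y} → i ≤ y → range i y ≡ i ∷ range (suc i) y
range-cons i≤y rewrite ℕ.+-∸-assoc 1 i≤y = refl

range-empty : ∀ y → range (suc y) y ≡ []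
range-empty y rewrite ℕ.n∸n≡0 y = refl

range-ind : ∀ {y} (P : ℕ → List ℕ → Set) → P (suc y) [] →
            (∀ {i} → i ≤ y → P (suc i) (range (suc i) y) → P i (i ∷ range (suc i) y)) →
            ∀ {i} → i ≤ suc y → P i (range i y)
range-ind {y} P P[] P∷ i≤sy = go (ℕ.≤⇒≤‴ i≤sy)
  where
  go : ∀ {i} → i ≤‴ suc y → P i (range i y)
  go ≤‴-refl = subst (P (suc y)) (sym (range-empty y)) P[]
  go {i} (≤‴-step si≤‴sy) = subst (P i) (sym (range-cons i≤y)) (P∷ i≤y (go si≤‴sy))
    where
    i≤y : i ≤ y
    i≤y = ℕ.≤-pred (ℕ.≤‴⇒≤ si≤‴sy)

∈-range⁺ : ∀ {i x y} → i ≤ x → x ≤ y → x ∈ range i y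
∈-range⁺ {x = x} {y} i≤x x≤y =
  range-ind (λ i L → i ≤ x → x ∈ L) (λ sy≤x → contradiction x≤y (ℕ.<⇒≱ sy≤x)) cons
    (ℕ.≤-trans i≤x (ℕ.m≤n⇒m≤1+n x≤y)) i≤x
  where
  cons : ∀ {i} → i ≤ y → (suc i ≤ x → x ∈ range (suc i) y) → i ≤ x → x ∈ i ∷ range (suc i) y
  cons _ ih i≤x with ℕ.m≤n⇒m<n∨m≡n i≤x
  ... | inj₁ i<x = there (ih i<x)
  ... | inj₂ refl = here refl

module _ {P : ℕ → Set} (P? : Decidable P) where

  firstSat-least : ∀ {d i x y} → i ≤ x → x ≤ y → P x →
                   let f = firstSat (does ∘ P?) d (range i y) in i ≤ f × f ≤ x × P f
  firstSat-least {d} {x = x} {y} i≤x x≤y Px =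
    range-ind Least (λ sy≤x → contradiction x≤y (ℕ.<⇒≱ sy≤x)) cons
      (ℕ.≤-trans i≤x (ℕ.m≤n⇒m≤1+n x≤y)) i≤x
    where
    Least : ℕ → List ℕ → Set
    Least i L = i ≤ x → let f = firstSat (does ∘ P?) d L in i ≤ f × f ≤ x × P f

    cons : ∀ {i} → i ≤ y → Least (suc i) (range (suc i) y) → Least i (i ∷ range (suc i) y)
    cons {i} _ ih i≤x with P? i
    ... | yes Pi = ℕ.≤-refl , i≤x , Pi
    ... | no ¬Pi with ℕ.m≤n⇒m<n∨m≡n i≤x
    ...   | inj₂ refl = contradiction Px ¬Pi
    ...   | inj₁ i<x = map₁ (ℕ.≤-trans (ℕ.n≤1+n i)) (ih i<x)

  lastSat-greatest : ∀ {i y} → i ≤ y → P i →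
                     let g = lastSat (does ∘ P?) i (range i y) in
                     g ≤ y × P g × (∀ {x} → x ≤ y → P x → x ≤ g)
  lastSat-greatest {i} {y} i≤y Pi =
    range-ind Greatest nil cons (ℕ.m≤n⇒m≤1+n i≤y) i≤y Pi (λ x<i _ → ℕ.<⇒≤ x<i)
    where
    select : ℕ → ℕ → ℕ
    select b x = if does (P? x) then x else b

    Greatest : ℕ → List ℕ → Set
    Greatest i L = ∀ {b} → b ≤ y → P b → (∀ {x} → x ℕ.< i → P x → x ≤ b) →
                   let g = foldl select b L in g ≤ y × P g × (∀ {x} → x ≤ y → P x → x ≤ g)

    nil : Greatest (suc y) []
    nil b≤y Pb below = b≤y , Pb , λ x≤y → below (s≤s x≤y)

    cons : ∀ {i} → i ≤ y → Greatest (suc i) (range (suc i) y) → Greatest i (i ∷ range (suc i) y)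
    cons {i} i≤y ih b≤y Pb below with P? i
    ... | yes Pi = ih i≤y Pi (λ x<si _ → ℕ.≤-pred x<si)
    ... | no ¬Pi = ih b≤y Pb below′
      where
      below′ : ∀ {x} → x ℕ.< suc i → P x → x ≤ _
      below′ x<si Px with ℕ.m≤n⇒m<n∨m≡n (ℕ.≤-pred x<si)
      ... | inj₁ x<i = below x<i Px
      ... | inj₂ refl = contradiction Px ¬Pi

record ArgMinOn (f : ℕ → ℚ) (lo hi m : ℕ) : Set where
  field
    lo≤m : lo ≤ m
    m≤hi : m ≤ hi
    minimal : ∀ {z} → lo ≤ z → z ≤ hi → f m ≤ℚ f z

record ArgMaxOn (f : ℕ → ℚ) (lo hi m : ℕ) : Set where
  field
    lo≤m : lo ≤ m
    m≤hi : m ≤ hi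
    maximal : ∀ {z} → lo ≤ z → z ≤ hi → f z ≤ℚ f m

module _ {f : ℕ → ℚ} where

  argmax-singleton : ∀ {i r} → i ≤ r → r ≤ i → ArgMaxOn f i r i
  argmax-singleton i≤r r≤i = record
    { lo≤m = ℕ.≤-refl
    ; m≤hi = i≤r
    ; maximal = λ i≤x x≤r → ℚ.≤-reflexive (cong f (ℕ.≤-antisym (ℕ.≤-trans x≤r r≤i) i≤x))
    }

  argmax-extendˡ : ∀ {i p r b} → i ≤ suc p → (∀ {x} → i ≤ x → x ≤ p → f x ≤ℚ f (suc p)) →
                   ArgMaxOn f (suc p) r b → ArgMaxOn f i r b
  argmax-extendˡ {p = p} {r} i≤sp beaten-by-sp argmax = record
    { lo≤m = ℕ.≤-trans i≤sp lo≤m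
    ; m≤hi = m≤hi
    ; maximal = λ {x} i≤x x≤r → Sum.[ (λ x≤p → ℚ.≤-trans (beaten-by-sp i≤x x≤p) (maximal ℕ.≤-refl sp≤r))
                                    , (λ p<x → maximal p<x x≤r) ]′ (ℕ.≤-<-connex x p)
    }
    where
    open ArgMaxOn argmax

    sp≤r : suc p ≤ r
    sp≤r = ℕ.≤-trans lo≤m m≤hi

argminStep : (ℕ → ℚ) → ℕ → ℕ → ℕ
argminStep f b z = if does (f z ℚ.≤? f b) then z else b

foldl-argminStep : ∀ f {lo y i b} → lo ≤ i → i ≤ suc y → lo ≤ b → b ≤ y →
                   (∀ {z} → lo ≤ z → z ℕ.< i → f b ≤ℚ f z) →
                   ArgMinOn f lo y (foldl (argminStep f) b (range i y))
foldl-argminStep f {lo} {y} lo≤i i≤sy = range-ind Scan nil cons i≤sy lo≤i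
  where
  Scan : ℕ → List ℕ → Set
  Scan i L = lo ≤ i → ∀ {b} → lo ≤ b → b ≤ y → (∀ {z} → lo ≤ z → z ℕ.< i → f b ≤ℚ f z) →
             ArgMinOn f lo y (foldl (argminStep f) b L)

  nil : Scan (suc y) []
  nil _ lo≤b b≤y below = record { lo≤m = lo≤b ; m≤hi = b≤y ; minimal = λ lo≤z z≤y → below lo≤z (s≤s z≤y) }

  cons : ∀ {i} → i ≤ y → Scan (suc i) (range (suc i) y) → Scan i (i ∷ range (suc i) y)
  -- The goal contains the decision f i ℚ.≤? f b only through its (normalised) does-component, so
  -- that Boolean is abstracted, together with the evidence carried by proof.
  cons {i} i≤y ih lo≤i {b} lo≤b b≤y below with does (f i ℚ.≤? f b) | proof (f i ℚ.≤? f b)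
  ... | true | ofʸ fi≤fb = ih (ℕ.m≤n⇒m≤1+n lo≤i) lo≤i i≤y below′
    where
    below′ : ∀ {z} → lo ≤ z → z ℕ.< suc i → f i ≤ℚ f z
    below′ lo≤z z<si with ℕ.m≤n⇒m<n∨m≡n (ℕ.≤-pred z<si)
    ... | inj₁ z<i = ℚ.≤-trans fi≤fb (below lo≤z z<i)
    ... | inj₂ refl = ℚ.≤-refl
  ... | false | ofⁿ fi≰fb = ih (ℕ.m≤n⇒m≤1+n lo≤i) lo≤b b≤y below′
    where
    below′ : ∀ {z} → lo ≤ z → z ℕ.< suc i → f b ≤ℚ f z
    below′ lo≤z z<si with ℕ.m≤n⇒m<n∨m≡n (ℕ.≤-pred z<si)
    ... | inj₁ z<i = below lo≤z z<i
    ... | inj₂ refl = ℚ.<⇒≤ (ℚ.≰⇒> fi≰fb)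

phi-argmin : ∀ {a w x y} → x ≤ y → ArgMinOn (D a w x) x y (phi a w x y)
phi-argmin {a} {w} {x} x≤y =
  foldl-argminStep (D a w x) ℕ.≤-refl (ℕ.m≤n⇒m≤1+n x≤y) ℕ.≤-refl x≤y
    (λ x≤z z<x → contradiction z<x (ℕ.≤⇒≯ x≤z))

sumFrom-+ : ∀ f i k l → sumFrom f i (k ℕ.+ l) ≡ sumFrom f i k + sumFrom f (i ℕ.+ k) l
sumFrom-+ f i zero l rewrite ℕ.+-identityʳ i = sym (ℚ.+-identityˡ (sumFrom f i l))
sumFrom-+ f i (suc k) l rewrite sumFrom-+ f (suc i) k l | ℕ.+-suc i k = sym (ℚ.+-assoc (f i) _ _)

rangeSum-split : ∀ f {i m j} → i ≤ suc m → m ≤ j → rangeSum f i j ≡ rangeSum f i m + rangeSum f (suc m) j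
rangeSum-split f {i} {m} {j} i≤sm m≤j = begin
  sumFrom f i (suc j ∸ i)                                       ≡⟨ cong (sumFrom f i) lengths ⟩
  sumFrom f i ((suc m ∸ i) ℕ.+ (j ∸ m))                         ≡⟨ sumFrom-+ f i (suc m ∸ i) (j ∸ m) ⟩
  sumFrom f i (suc m ∸ i) + sumFrom f (i ℕ.+ (suc m ∸ i)) (j ∸ m) ≡⟨ cong (λ k → sumFrom f i (suc m ∸ i) + sumFrom f k (j ∸ m)) (ℕ.m+[n∸m]≡n i≤sm) ⟩
  sumFrom f i (suc m ∸ i) + sumFrom f (suc m) (j ∸ m)           ∎
  where
  open ≡-Reasoning
  lengths : suc j ∸ i ≡ (suc m ∸ i) ℕ.+ (j ∸ m)
  lengths = begin
    suc j ∸ i                    ≡⟨ cong (_∸ i) (sym (ℕ.m+[n∸m]≡n (s≤s m≤j))) ⟩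
    (suc m ℕ.+ (j ∸ m)) ∸ i      ≡⟨ ℕ.+-∸-comm (j ∸ m) i≤sm ⟩
    (suc m ∸ i) ℕ.+ (j ∸ m)      ∎

p≤p+q : ∀ {p q} → 0ℚ ≤ℚ q → p ≤ℚ p + q
p≤p+q {p} {q} 0≤q = subst (_≤ℚ p + q) (ℚ.+-identityʳ p) (ℚ.+-monoʳ-≤ p 0≤q)

p≤q+p : ∀ {p q} → 0ℚ ≤ℚ q → p ≤ℚ q + p
p≤q+p {p} {q} 0≤q = subst (_≤ℚ q + p) (ℚ.+-identityˡ p) (ℚ.+-monoˡ-≤ p 0≤q)

-- vmain iterates a where-bound function, which cannot be named outside Defs.  vmainLoop is a
-- metavariable; checking vmain-unfold solves it, by unification, to exactly that function.
mutual
  vmainLoop : ℕ → (ℕ → ℚ) → (ℕ → ℚ) → ℚ → ℚ → ℕ → ℕ → ℕ → ℕ → ℕ → List (ℕ × ℕ)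
  vmainLoop = _

  vmain-unfold : ∀ n a w wmin wmax r y0 k → suc k ≡ suc (yOne n w wmax r) ∸ y0 →
                 vmain n a w wmin wmax r y0 ≡ (best a w (vmainEll n w wmax y0 ⊔ ellOf w wmin wmax y0) r y0 , y0)
                   ∷ vmainLoop n a w wmin wmax r y0 k (suc y0) (best a w (vmainEll n w wmax y0 ⊔ ellOf w wmin wmax y0) r y0)
  vmain-unfold n a w wmin wmax r y0 k eq with suc (yOne n w wmax r) ∸ y0 | eq
  ... | .(suc k) | refl with best a w (vmainEll n w wmax y0 ⊔ ellOf w wmin wmax y0) r y0
  ... | x0 with suc y0
  ... | y = refl

-- Densities of segments

module PositiveWeights {n : ℕ} {w : ℕ → ℚ} (w-pos : ∀ i → 1 ≤ i → i ≤ n → 0ℚ < w i) where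

  sumFrom-nonneg : ∀ {i} len → 1 ≤ i → i ℕ.+ len ≤ suc n → 0ℚ ≤ℚ sumFrom w i len
  sumFrom-nonneg zero _ _ = ℚ.≤-refl
  sumFrom-nonneg {i} (suc len) 1≤i bound =
    ℚ.+-mono-≤ (ℚ.<⇒≤ (w-pos i 1≤i (ℕ.≤-trans (ℕ.m≤m+n i len) (ℕ.≤-pred si+len≤sn))))
               (sumFrom-nonneg len (s≤s z≤n) si+len≤sn)
    where
    si+len≤sn : suc i ℕ.+ len ≤ suc n
    si+len≤sn = subst (_≤ suc n) (ℕ.+-suc i len) bound

  W-nonneg : ∀ {i j} → 1 ≤ i → i ≤ suc j → j ≤ n → 0ℚ ≤ℚ W w i j
  W-nonneg 1≤i i≤sj j≤n = sumFrom-nonneg _ 1≤i (subst (_≤ suc n) (sym (ℕ.m+[n∸m]≡n i≤sj)) (s≤s j≤n))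

  W-cons : ∀ {i j} → i ≤ j → W w i j ≡ w i + W w (suc i) j
  W-cons i≤j rewrite ℕ.+-∸-assoc 1 i≤j = refl

  W-pos : ∀ {i j} → 1 ≤ i → i ≤ j → j ≤ n → 0ℚ < W w i j
  W-pos {i} 1≤i i≤j j≤n rewrite W-cons i≤j =
    ℚ.+-mono-<-≤ (w-pos i 1≤i (ℕ.≤-trans i≤j j≤n)) (W-nonneg (s≤s z≤n) (s≤s i≤j) j≤n)

  W-⊆ : ∀ {x x′ y′ y} → 1 ≤ x → x ≤ x′ → x′ ≤ suc y′ → y′ ≤ y → y ≤ n → W w x′ y′ ≤ℚ W w x y
  W-⊆ {x′ = zero} (s≤s z≤n) () _ _ _
  W-⊆ {x} {suc m} {y′} {y} 1≤x x≤x′ x′≤sy′ y′≤y y≤n = ℚ.≤-trans extendʳ extendˡ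
    where
    extendʳ : W w (suc m) y′ ≤ℚ W w (suc m) y
    extendʳ rewrite rangeSum-split w x′≤sy′ y′≤y = p≤p+q (W-nonneg (s≤s z≤n) (s≤s y′≤y) y≤n)
    m≤y : m ≤ y
    m≤y = ℕ.≤-trans (ℕ.≤-pred x′≤sy′) y′≤y
    extendˡ : W w (suc m) y ≤ℚ W w x y
    extendˡ rewrite rangeSum-split w x≤x′ m≤y = p≤q+p (W-nonneg 1≤x x≤x′ (ℕ.≤-trans m≤y y≤n))

  module Densities (a : ℕ → ℚ) where

    module Split {i m j : ℕ} (1≤i : 1 ≤ i) (i≤m : i ≤ m) (m<j : m ℕ.< j) (j≤n : j ≤ n) where

      private
        0<left : 0ℚ < W w i m
        0<left = W-pos 1≤i i≤m (ℕ.≤-trans (ℕ.<⇒≤ m<j) j≤n)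

        0<right : 0ℚ < W w (suc m) j
        0<right = W-pos (s≤s z≤n) m<j j≤n

        split : ∀ f → rangeSum f i j ≡ rangeSum f i m + rangeSum f (suc m) j
        split f = rangeSum-split f (ℕ.m≤n⇒m≤1+n i≤m) (ℕ.<⇒≤ m<j)

        whole≡ : D a w i j ≡ div (rangeSum a i m + rangeSum a (suc m) j) (W w i m + W w (suc m) j)
        whole≡ = cong₂ div (split a) (split w)

        whole≡swapped : D a w i j ≡ div (rangeSum a (suc m) j + rangeSum a i m) (W w (suc m) j + W w i m)
        whole≡swapped = trans whole≡ (mediant-comm (rangeSum a i m) (W w i m) (rangeSum a (suc m) j) (W w (suc m) j))

      left≤right⇔left≤whole : D a w i m ≤ℚ D a w (suc m) j ⇔ D a w i m ≤ℚ D a w i j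
      left≤right⇔left≤whole rewrite whole≡ = ≤⇔≤-mediant 0<left 0<right

      left≤right⇔whole≤right : D a w i m ≤ℚ D a w (suc m) j ⇔ D a w i j ≤ℚ D a w (suc m) j
      left≤right⇔whole≤right rewrite whole≡ = ≤⇔mediant-≤ 0<left 0<right

      right≤left⇔right≤whole : D a w (suc m) j ≤ℚ D a w i m ⇔ D a w (suc m) j ≤ℚ D a w i j
      right≤left⇔right≤whole rewrite whole≡swapped = ≤⇔≤-mediant 0<right 0<left

      right≤left⇔whole≤left : D a w (suc m) j ≤ℚ D a w i m ⇔ D a w i j ≤ℚ D a w i m
      right≤left⇔whole≤left rewrite whole≡swapped = ≤⇔mediant-≤ 0<right 0<left

      whole≤ : ∀ {c} → D a w i m ≤ℚ c → D a w (suc m) j ≤ℚ c → D a w i j ≤ℚ c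
      whole≤ rewrite whole≡ = mediant-≤ 0<left 0<right

    start-argmax : ∀ {i r j} → 1 ≤ i → i ≤ r → r ≤ j → j ≤ n →
                   (∀ {m} → i ≤ m → m ℕ.< r → D a w i j ≤ℚ D a w i m) →
                   ArgMaxOn (λ x → D a w x j) i r i
    start-argmax {i} {r} {j} 1≤i i≤r r≤j j≤n prefixes-denser =
      record { lo≤m = ℕ.≤-refl ; m≤hi = i≤r ; maximal = maximal }
      where
      maximal : ∀ {x} → i ≤ x → x ≤ r → D a w x j ≤ℚ D a w i j
      maximal i≤x x≤r with ℕ.m≤n⇒m<n∨m≡n i≤x
      ... | inj₂ refl = ℚ.≤-refl
      ... | inj₁ (s≤s i≤m) =
        to right≤left⇔right≤whole (from right≤left⇔whole≤left (prefixes-denser i≤m x≤r))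
        where
        open Split 1≤i i≤m (ℕ.<-≤-trans x≤r r≤j) j≤n

    past-min-prefix-dominates : ∀ {i p j} → 1 ≤ i → i ≤ p → p ℕ.< j → j ≤ n →
      (∀ {m} → i ≤ m → m ℕ.< p → D a w i p ≤ℚ D a w i m) → D a w i p ≤ℚ D a w i j →
      ∀ {x} → i ≤ x → x ≤ p → D a w x j ≤ℚ D a w (suc p) j
    past-min-prefix-dominates {i} {p} {j} 1≤i i≤p p<j j≤n min-prefix ip≤ij = dominated
      where
      module Whole = Split 1≤i i≤p p<j j≤n

      prefix≤rest : D a w i p ≤ℚ D a w (suc p) j
      prefix≤rest = from Whole.left≤right⇔left≤whole ip≤ij

      dominated : ∀ {x} → i ≤ x → x ≤ p → D a w x j ≤ℚ D a w (suc p) j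
      dominated i≤x x≤p with ℕ.m≤n⇒m<n∨m≡n i≤x
      ... | inj₂ refl = to Whole.left≤right⇔whole≤right prefix≤rest
      ... | inj₁ (s≤s {n = m} i≤m) = to Tail.left≤right⇔whole≤right (ℚ.≤-trans middle≤prefix prefix≤rest)
        where
        module Prefix = Split 1≤i i≤m x≤p (ℕ.≤-trans (ℕ.<⇒≤ p<j) j≤n)
        module Tail = Split (s≤s z≤n) x≤p p<j j≤n

        middle≤prefix : D a w (suc m) p ≤ℚ D a w i p
        middle≤prefix = to Prefix.right≤left⇔right≤whole (from Prefix.right≤left⇔whole≤left (min-prefix i≤m x≤p))

    D-crossing : ∀ {i u y y′} → 1 ≤ i → i ℕ.< u → u ≤ y → u ≤ y′ → y ≤ n → y′ ≤ n →
                 D a w i y ≤ℚ D a w u y → D a w u y′ ≤ℚ D a w i y′ → D a w i y′ ≤ℚ D a w u y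
    D-crossing {i} {y = y} {y′} 1≤i (s≤s {n = m} i≤m) u≤y u≤y′ y≤n y′≤n iy≤uy uy′≤iy′ =
      Second.whole≤ prefix≤uy (ℚ.≤-trans uy′≤prefix prefix≤uy)
      where
      module First = Split 1≤i i≤m u≤y y≤n
      module Second = Split 1≤i i≤m u≤y′ y′≤n

      prefix≤uy : D a w i m ≤ℚ D a w (suc m) y
      prefix≤uy = from First.left≤right⇔whole≤right iy≤uy

      uy′≤prefix : D a w (suc m) y′ ≤ℚ D a w i m
      uy′≤prefix = from Second.right≤left⇔right≤whole uy′≤iy′

    bestFuel-argmax : ∀ {r j} fuel {i} → 1 ≤ i → i ≤ r → r ≤ fuel ℕ.+ i → r ≤ j → j ≤ n →
                      ArgMaxOn (λ x → D a w x j) i r (bestFuel a w r j fuel i)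
    bestFuel-argmax zero _ i≤r r≤i _ _ = argmax-singleton i≤r r≤i
    bestFuel-argmax {r} {j} (suc fuel) {i} 1≤i i≤r r≤fuel+i r≤j j≤n
      with does (i ℕ.<? r) | proof (i ℕ.<? r)
    ... | false | ofⁿ i≮r = argmax-singleton i≤r (ℕ.≮⇒≥ i≮r)
    ... | true | ofʸ (s≤s {n = r′} i≤r′)
      with does (D a w i (phi a w i r′) ℚ.≤? D a w i j) | proof (D a w i (phi a w i r′) ℚ.≤? D a w i j)
    ...   | false | ofⁿ ip≰ij = start-argmax 1≤i i≤r r≤j j≤n prefixes-denser
      where
      open ArgMinOn (phi-argmin {a} {w} i≤r′)
      prefixes-denser : ∀ {m} → i ≤ m → m ℕ.< r → D a w i j ≤ℚ D a w i m
      prefixes-denser i≤m m<r = ℚ.≤-trans (ℚ.<⇒≤ (ℚ.≰⇒> ip≰ij)) (minimal i≤m (ℕ.≤-pred m<r))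
    ...   | true | ofʸ ip≤ij = argmax-extendˡ (ℕ.m≤n⇒m≤1+n i≤p) beaten-by-sp rest
      where
      open ArgMinOn (phi-argmin {a} {w} i≤r′) renaming (lo≤m to i≤p; m≤hi to p≤r′)

      p : ℕ
      p = phi a w i r′

      min-prefix : ∀ {m} → i ≤ m → m ℕ.< p → D a w i p ≤ℚ D a w i m
      min-prefix i≤m m<p = minimal i≤m (ℕ.≤-trans (ℕ.<⇒≤ m<p) p≤r′)

      beaten-by-sp : ∀ {x} → i ≤ x → x ≤ p → D a w x j ≤ℚ D a w (suc p) j
      beaten-by-sp = past-min-prefix-dominates 1≤i i≤p (ℕ.<-≤-trans (s≤s p≤r′) r≤j) j≤n min-prefix ip≤ij

      r≤fuel+sp : r ≤ fuel ℕ.+ suc p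
      r≤fuel+sp = ℕ.≤-trans r≤fuel+i (ℕ.≤-trans (s≤s (ℕ.+-monoʳ-≤ fuel i≤p)) (ℕ.≤-reflexive (sym (ℕ.+-suc fuel p))))

      rest : ArgMaxOn (λ x → D a w x j) (suc p) r (bestFuel a w r j fuel (suc p))
      rest = bestFuel-argmax fuel (s≤s z≤n) (s≤s p≤r′) r≤fuel+sp r≤j j≤n

    best-argmax : ∀ {ℓ r j} → 1 ≤ ℓ → ℓ ≤ r → r ≤ j → j ≤ n →
                  ArgMaxOn (λ x → D a w x j) ℓ r (best a w ℓ r j)
    best-argmax {ℓ} {r} 1≤ℓ ℓ≤r = bestFuel-argmax (suc r) 1≤ℓ ℓ≤r (ℕ.≤-trans (ℕ.n≤1+n r) (ℕ.m≤m+n (suc r) ℓ))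

    module VMain (wmin wmax : ℚ) {r y0 : ℕ} (1≤r : 1 ≤ r) (r≤y0 : r ≤ y0) (y0≤n : y0 ≤ n)
                 (wmin≤Wry0 : wmin ≤ℚ W w r y0) (Wry0≤wmax : W w r y0 ≤ℚ wmax) where

      y1 : ℕ
      y1 = yOne n w wmax r

      ℓ : ℕ → ℕ
      ℓ = ellOf w wmin wmax

      InBounds : ℕ → ℕ → Set
      InBounds x y = wmin ≤ℚ W w x y × W w x y ≤ℚ wmax

      Feasible : ℕ × ℕ → Set
      Feasible (x , y) = ℓ y0 ≤ x × x ≤ r × y0 ≤ y × y ≤ y1 × InBounds x y

      feasible? : Decidable Feasible
      feasible? (x , y) = ℓ y0 ℕ.≤? x ×-dec x ℕ.≤? r ×-dec y0 ℕ.≤? y ×-dec y ℕ.≤? y1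
                          ×-dec wmin ℚ.≤? W w x y ×-dec W w x y ℚ.≤? wmax

      r≤n : r ≤ n
      r≤n = ℕ.≤-trans r≤y0 y0≤n

      wmin≤W : ∀ {x y} → 1 ≤ x → x ≤ r → y0 ≤ y → y ≤ n → wmin ≤ℚ W w x y
      wmin≤W 1≤x x≤r y0≤y y≤n = ℚ.≤-trans wmin≤Wry0 (W-⊆ 1≤x x≤r (ℕ.m≤n⇒m≤1+n r≤y0) y0≤y y≤n)

      private
        y1-greatest : y1 ≤ n × W w r y1 ≤ℚ wmax × (∀ {y} → y ≤ n → W w r y ≤ℚ wmax → y ≤ y1)
        y1-greatest = lastSat-greatest (λ y → W w r y ℚ.≤? wmax) r≤n
          (ℚ.≤-trans (W-⊆ 1≤r ℕ.≤-refl (ℕ.n≤1+n r) r≤y0 y0≤n) Wry0≤wmax)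

      y1≤n : y1 ≤ n
      y1≤n = proj₁ y1-greatest

      Wry1≤wmax : W w r y1 ≤ℚ wmax
      Wry1≤wmax = proj₁ (proj₂ y1-greatest)

      y0≤y1 : y0 ≤ y1
      y0≤y1 = proj₂ (proj₂ y1-greatest) y0≤n Wry0≤wmax

      module _ {y : ℕ} (y0≤y : y0 ≤ y) (y≤y1 : y ≤ y1) where

        private
          y≤n : y ≤ n
          y≤n = ℕ.≤-trans y≤y1 y1≤n

          r≤y : r ≤ y
          r≤y = ℕ.≤-trans r≤y0 y0≤y

          r-inBounds : InBounds r y
          r-inBounds = wmin≤W 1≤r ℕ.≤-refl y0≤y y≤n
                     , ℚ.≤-trans (W-⊆ 1≤r ℕ.≤-refl (ℕ.m≤n⇒m≤1+n r≤y) y≤y1 y1≤n) Wry1≤wmax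

          inBounds? : Decidable (λ x → InBounds x y)
          inBounds? x = wmin ℚ.≤? W w x y ×-dec W w x y ℚ.≤? wmax

          ℓ-first : 1 ≤ ℓ y × ℓ y ≤ r × InBounds (ℓ y) y
          ℓ-first = firstSat-least inBounds? 1≤r r≤y r-inBounds

        1≤ℓ : 1 ≤ ℓ y
        1≤ℓ = proj₁ ℓ-first

        ℓ≤r : ℓ y ≤ r
        ℓ≤r = proj₁ (proj₂ ℓ-first)

        ℓ-inBounds : InBounds (ℓ y) y
        ℓ-inBounds = proj₂ (proj₂ ℓ-first)

        ℓ-least : ∀ {x} → 1 ≤ x → x ≤ r → W w x y ≤ℚ wmax → ℓ y ≤ x
        ℓ-least 1≤x x≤r Wxy≤wmax =
          proj₁ (proj₂ (firstSat-least inBounds? 1≤x (ℕ.≤-trans x≤r r≤y) (wmin≤W 1≤x x≤r y0≤y y≤n , Wxy≤wmax)))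

      ℓ-feasible : ∀ {y} → y0 ≤ y → y ≤ y1 → Feasible (ℓ y , y)
      ℓ-feasible {y} y0≤y y≤y1 = ℓy0≤ℓy , ℓ≤r y0≤y y≤y1 , y0≤y , y≤y1 , ℓ-inBounds y0≤y y≤y1
        where
        ℓy0≤ℓy : ℓ y0 ≤ ℓ y
        ℓy0≤ℓy = ℓ-least ℕ.≤-refl y0≤y1 (1≤ℓ y0≤y y≤y1) (ℓ≤r y0≤y y≤y1)
          (ℚ.≤-trans (W-⊆ (1≤ℓ y0≤y y≤y1) ℕ.≤-refl (ℕ.≤-trans (ℓ≤r y0≤y y≤y1) (ℕ.m≤n⇒m≤1+n r≤y0)) y0≤y
                          (ℕ.≤-trans y≤y1 y1≤n))
                     (proj₂ (ℓ-inBounds y0≤y y≤y1)))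

      feasible-later-start : ∀ {x x′ y} → Feasible (x , y) → x ≤ x′ → x′ ≤ r → Feasible (x′ , y)
      feasible-later-start {x} {x′} {y} (ℓy0≤x , _ , y0≤y , y≤y1 , _ , Wxy≤wmax) x≤x′ x′≤r =
          ℕ.≤-trans ℓy0≤x x≤x′ , x′≤r , y0≤y , y≤y1
        , wmin≤W 1≤x′ x′≤r y0≤y y≤n
        , ℚ.≤-trans (W-⊆ 1≤x x≤x′ (ℕ.m≤n⇒m≤1+n (ℕ.≤-trans x′≤r (ℕ.≤-trans r≤y0 y0≤y))) ℕ.≤-refl y≤n) Wxy≤wmax
        where
        y≤n : y ≤ n
        y≤n = ℕ.≤-trans y≤y1 y1≤n

        1≤x : 1 ≤ x
        1≤x = ℕ.≤-trans (1≤ℓ ℕ.≤-refl y0≤y1) ℓy0≤x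

        1≤x′ : 1 ≤ x′
        1≤x′ = ℕ.≤-trans 1≤x x≤x′

      density : ℕ × ℕ → ℚ
      density (x , y) = D a w x y

      private
        r,y0-feasible : Feasible (r , y0)
        r,y0-feasible = feasible-later-start (ℓ-feasible ℕ.≤-refl y0≤y1) (ℓ≤r ℕ.≤-refl y0≤y1) ℕ.≤-refl

        box : List (ℕ × ℕ)
        box = cartesianProduct (range (ℓ y0) r) (range y0 y1)

        candidates : List (ℕ × ℕ)
        candidates = filter feasible? box

      optimum : ℕ × ℕ
      optimum = argmax density (r , y0) candidates

      optimum-feasible : Feasible optimum
      optimum-feasible = argmax-all density r,y0-feasible (all-filter feasible? box)

      optimum-maximal : ∀ {q} → Feasible q → density q ≤ℚ density optimum
      optimum-maximal q-feasible@(ℓy0≤x , x≤r , y0≤y , y≤y1 , _) =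
        lookup (f[xs]≤f[argmax] (r , y0) candidates)
          (∈-filter⁺ feasible? (∈-cartesianProduct⁺ (∈-range⁺ ℓy0≤x x≤r) (∈-range⁺ y0≤y y≤y1)) q-feasible)

      Dominant : ℕ × ℕ → Set
      Dominant q = Feasible q × density optimum ≤ℚ density q

      private
        x⋆ y⋆ : ℕ
        x⋆ = proj₁ optimum
        y⋆ = proj₂ optimum

        ℓy0≤x⋆ : ℓ y0 ≤ x⋆
        ℓy0≤x⋆ = proj₁ optimum-feasible

        x⋆≤r : x⋆ ≤ r
        x⋆≤r = proj₁ (proj₂ optimum-feasible)

        y0≤y⋆ : y0 ≤ y⋆
        y0≤y⋆ = proj₁ (proj₂ (proj₂ optimum-feasible))

        y⋆≤y1 : y⋆ ≤ y1
        y⋆≤y1 = proj₁ (proj₂ (proj₂ (proj₂ optimum-feasible)))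

        Wx⋆y⋆≤wmax : W w x⋆ y⋆ ≤ℚ wmax
        Wx⋆y⋆≤wmax = proj₂ (proj₂ (proj₂ (proj₂ (proj₂ optimum-feasible))))

        y⋆≤n : y⋆ ≤ n
        y⋆≤n = ℕ.≤-trans y⋆≤y1 y1≤n

        1≤x⋆ : 1 ≤ x⋆
        1≤x⋆ = ℕ.≤-trans (1≤ℓ ℕ.≤-refl y0≤y1) ℓy0≤x⋆

        Wx⋆≤wmax : ∀ {y} → y0 ≤ y → y ≤ y⋆ → W w x⋆ y ≤ℚ wmax
        Wx⋆≤wmax y0≤y y≤y⋆ =
          ℚ.≤-trans (W-⊆ 1≤x⋆ ℕ.≤-refl (ℕ.m≤n⇒m≤1+n (ℕ.≤-trans x⋆≤r (ℕ.≤-trans r≤y0 y0≤y))) y≤y⋆ y⋆≤n) Wx⋆y⋆≤wmax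

      module Step {y xprev : ℕ} (y0≤y : y0 ≤ y) (y≤y⋆ : y ≤ y⋆) (xprev≤x⋆ : xprev ≤ x⋆) where

        private
          y≤y1 : y ≤ y1
          y≤y1 = ℕ.≤-trans y≤y⋆ y⋆≤y1

          y≤n : y ≤ n
          y≤n = ℕ.≤-trans y≤y1 y1≤n

          r≤y : r ≤ y
          r≤y = ℕ.≤-trans r≤y0 y0≤y

          start : ℕ
          start = xprev ⊔ ℓ y

          ℓy≤start : ℓ y ≤ start
          ℓy≤start = ℕ.m≤n⊔m xprev (ℓ y)

          start≤x⋆ : start ≤ x⋆
          start≤x⋆ = ℕ.⊔-lub xprev≤x⋆ (ℓ-least y0≤y y≤y1 1≤x⋆ x⋆≤r (Wx⋆≤wmax y0≤y y≤y⋆))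

          1≤start : 1 ≤ start
          1≤start = ℕ.≤-trans (1≤ℓ y0≤y y≤y1) ℓy≤start

        output : ℕ
        output = best a w start r y

        open ArgMaxOn (best-argmax 1≤start (ℕ.≤-trans start≤x⋆ x⋆≤r) r≤y y≤n)

        output-feasible : Feasible (output , y)
        output-feasible = feasible-later-start (ℓ-feasible y0≤y y≤y1) (ℕ.≤-trans ℓy≤start lo≤m) m≤hi

        x⋆-dominated : D a w x⋆ y ≤ℚ D a w output y
        x⋆-dominated = maximal start≤x⋆ x⋆≤r

        overshoot-dominant : x⋆ ℕ.< output → Dominant (output , y)
        overshoot-dominant x⋆<output = output-feasible ,
          D-crossing 1≤x⋆ x⋆<output (ℕ.≤-trans m≤hi r≤y) (ℕ.≤-trans m≤hi (ℕ.≤-trans r≤y0 y0≤y⋆)) y≤n y⋆≤n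
            x⋆-dominated (optimum-maximal (feasible-later-start optimum-feasible (ℕ.<⇒≤ x⋆<output) m≤hi))

        behind-or-dominant : output ≤ x⋆ ⊎ Dominant (output , y)
        behind-or-dominant = Sum.map₂ overshoot-dominant (ℕ.≤-<-connex output x⋆)

        loop-unfold : vmainLoop n a w wmin wmax r y0 (suc y1 ∸ y) y xprev
                    ≡ (output , y) ∷ vmainLoop n a w wmin wmax r y0 (suc y1 ∸ suc y) (suc y) output
        loop-unfold = cong (λ k → vmainLoop n a w wmin wmax r y0 k y xprev) (ℕ.+-∸-assoc 1 y≤y1)

      loop-finds : ∀ {y xprev} → y0 ≤ y → y ≤‴ y⋆ → xprev ≤ x⋆ →
                   Any Dominant (vmainLoop n a w wmin wmax r y0 (suc y1 ∸ y) y xprev)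
      loop-finds y0≤y ≤‴-refl xprev≤x⋆ =
        subst (Any Dominant) (sym loop-unfold) (here (output-feasible , x⋆-dominated))
        where
        open Step y0≤y ℕ.≤-refl xprev≤x⋆
      loop-finds y0≤y (≤‴-step sy≤‴y⋆) xprev≤x⋆ =
        subst (Any Dominant) (sym loop-unfold)
          (Sum.[ there ∘ loop-finds (ℕ.m≤n⇒m≤1+n y0≤y) sy≤‴y⋆ , here ]′ behind-or-dominant)
        where
        open Step y0≤y (ℕ.≤‴⇒≤ (≤‴-step sy≤‴y⋆)) xprev≤x⋆

      vmain-attains-optimum : Σ (ℕ × ℕ) λ p → p ∈ vmain n a w wmin wmax r y0 × Dominant p
      vmain-attains-optimum = find (loop-finds ℕ.≤-refl (ℕ.≤⇒≤‴ y0≤y⋆) vmainEll≤x⋆)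
        where
        vmainEll≤x⋆ : vmainEll n w wmax y0 ≤ x⋆
        vmainEll≤x⋆ = proj₁ (proj₂ (firstSat-least (λ x → W w x y0 ℚ.≤? wmax)
          1≤x⋆ (ℕ.≤-trans x⋆≤r r≤n) (Wx⋆≤wmax ℕ.≤-refl y0≤y⋆)))

lemma4 : (n : ℕ) (a w : ℕ → ℚ) (wmin wmax : ℚ)
  → (∀ i → 1 ≤ i → i ≤ n → 0ℚ < w i)
  → (r y0 : ℕ) → 1 ≤ r → r ≤ y0 → y0 ≤ n
  → wmin ≤ℚ W w r y0
  → W w r y0 ≤ℚ wmax
  → Σ (ℕ × ℕ) λ p →
      p ∈ vmain n a w wmin wmax r y0
      × wmin ≤ℚ W w (proj₁ p) (proj₂ p) × W w (proj₁ p) (proj₂ p) ≤ℚ wmax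
      × (Σ ℕ λ x → Σ ℕ λ y →
           ellOf w wmin wmax y0 ≤ x × x ≤ r × y0 ≤ y × y ≤ yOne n w wmax r
           × wmin ≤ℚ W w x y × W w x y ≤ℚ wmax × D a w x y ≡ D a w (proj₁ p) (proj₂ p))
      × (∀ x y → ellOf w wmin wmax y0 ≤ x → x ≤ r → y0 ≤ y → y ≤ yOne n w wmax r
           → wmin ≤ℚ W w x y → W w x y ≤ℚ wmax → D a w x y ≤ℚ D a w (proj₁ p) (proj₂ p))
lemma4 n a w wmin wmax w-pos r y0 1≤r r≤y0 y0≤n wmin≤Wry0 Wry0≤wmax =
  let (x , y) , p∈vmain , (ℓy0≤x , x≤r , y0≤y , y≤y1 , wmin≤Wxy , Wxy≤wmax) , optimum≤p = vmain-attains-optimum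
  in (x , y) , p∈vmain , wmin≤Wxy , Wxy≤wmax
   , (x , y , ℓy0≤x , x≤r , y0≤y , y≤y1 , wmin≤Wxy , Wxy≤wmax , refl)
   , λ x′ y′ ℓy0≤x′ x′≤r y0≤y′ y′≤y1 wmin≤Wx′y′ Wx′y′≤wmax →
       ℚ.≤-trans (optimum-maximal (ℓy0≤x′ , x′≤r , y0≤y′ , y′≤y1 , wmin≤Wx′y′ , Wx′y′≤wmax)) optimum≤p
  where
  open PositiveWeights w-pos
  open Densities a
  open VMain wmin wmax 1≤r r≤y0 y0≤n wmin≤Wry0 Wry0≤wmax
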